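{- Let $(X, \delta\colon X \rightarrow (\mathcal{P}_{\omega} X)^A)$ be an LTS. Then for all $x\in X$ and $w\in A^*$, $[\![ \{x\} ]\!](w) = \varphi^{\mathcal{PF}}_{x}(w)$.
   Context: An LTS is a pair $(X,\delta\colon X\to(\mathcal{P}_\omega X)^A)$ ($\mathcal{P}_\omega$ = finite powerset); write $x\xrightarrow{a}y$ iff $y\in\delta(x)(a)$, extended to words. Let $\mathcal{T}(x)=\{w\in A^*\mid\exists x'.\ x\xrightarrow{w}x'\}$ be the set of traces of $x$. The LTS is decorated with $\overline{o}_{\mathcal{PF}}\colon X\to B=\mathcal{P}(\mathcal{P}(A^*))$, $\overline{o}_{\mathcal{PF}}(x)=\{\mathcal{T}(x)\}$, and determinised into $(\mathcal{P}_\omega X,\langle o,t\rangle)$ with $o(Y)=\bigcup_{y\in Y}\overline{o}_{\mathcal{PF}}(y)$ and $t(Y)(a)=\bigcup_{y\in Y}\delta(y)(a)$; $[\![-]\!]\colon\mathcal{P}_\omega X\to B^{A^*}$ is the unique map into the final Moore coalgebra, $[\![Y]\!](\varepsilon)=o(Y)$, $[\![Y]\!](aw)=[\![t(Y)(a)]\!](w)$. Finally $\varphi^{\mathcal{PF}}_x(w)=\{\mathcal{T}(y)\mid x\xrightarrow{w}y\}$, which encodes the set of possible futures of $x$. -}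

module Defs where

open import Level using (0ℓ)
open import Data.List using (List; []; _∷_; concatMap)
open import Data.List.Membership.Propositional using (_∈_)
open import Data.Product using (Σ; ∃; _×_; _,_)
open import Function.Bundles using (_⇔_)

-- Finite powerset P_ω X represented by finite lists (membership-based).
Pω : Set → Set
Pω X = List X

record LTS (A : Set) : Set₁ where
  field
    X : Set
    δ : X → A → Pω X

module _ {A : Set} (L : LTS A) where
  open LTS L

  _─_⟶_ : X → A → X → Set
  x ─ a ⟶ y = y ∈ δ x a

  data _⟹[_]_ : X → List A → X → Set where
    ε-step : ∀ {x} → x ⟹[ [] ] x
    ∷-step : ∀ {x y z a w} → x ─ a ⟶ y → y ⟹[ w ] z → x ⟹[ a ∷ w ] z

  -- subsets of A* as predicates
  Lang : Set₁
  Lang = List A → Set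

  _≐_ : Lang → Lang → Set
  U ≐ V = ∀ w → (U w ⇔ V w)

  T : X → Lang
  T x w = ∃ λ x' → x ⟹[ w ] x'

  -- B = P(P(A*)), a set of subsets of A* (membership respects ≐ in all uses below)
  B : Set₁
  B = Lang → Set

  _≈B_ : B → B → Set₁
  S ≈B S' = ∀ U → (S U ⇔ S' U)

  ōPF : X → B
  ōPF x U = U ≐ T x

  o : Pω X → B
  o Y U = ∃ λ y → (y ∈ Y) × ōPF y U

  t : Pω X → A → Pω X
  t Y a = concatMap (λ y → δ y a) Y

  -- the unique map into the final Moore coalgebra B^{A*}
  ⟦_⟧ : Pω X → List A → B
  ⟦ Y ⟧ [] = o Y
  ⟦ Y ⟧ (a ∷ w) = ⟦ t Y a ⟧ w

  φPF : X → List A → B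
  φPF x w U = ∃ λ y → (x ⟹[ w ] y) × (U ≐ T y)

module Submission where

-- The determinised semantics ⟦ Y ⟧ w collects the trace sets T(z) of all
-- states z reachable by w from SOME state of the set Y; for Y = {x} this is
-- exactly φ^PF_x(w), the possible futures of x after w.
--
-- We make this precise for arbitrary finite sets Y.

open import Defs
open import Data.List using (List; []; _∷_)
open import Data.List.Membership.Propositional using (_∈_; find; lose)
open import Data.List.Membership.Propositional.Properties
  using (∈-concatMap⁺; ∈-concatMap⁻)
open import Data.List.Relation.Unary.Any using (here)
open import Data.Product using (∃; _×_; _,_)
open import Function.Bundles using (_⇔_; mk⇔; module Equivalence)
open import Function.Properties.Equivalence using () renaming (trans to ⇔-trans)
open import Relation.Binary.PropositionalEquality using (refl)

module _ {A : Set} (L : LTS A) where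
  open LTS L

  t-membership : ∀ {z a} (Y : List X) →
    z ∈ t L Y a ⇔ (∃ λ y → y ∈ Y × _─_⟶_ L y a z)
  t-membership {a = a} Y = mk⇔
    (λ z∈tY → find (∈-concatMap⁻ (λ y → δ y a) z∈tY))
    (λ (y , y∈Y , y⟶z) → ∈-concatMap⁺ (λ y → δ y a) (lose y∈Y y⟶z))

  reachableFutures : List X → List A → B L
  reachableFutures Y w U =
    ∃ λ y → y ∈ Y × (∃ λ z → _⟹[_]_ L y w z × _≐_ L U (T L z))

  reachable-step : ∀ Y a w →
    _≈B_ L (reachableFutures (t L Y a) w) (reachableFutures Y (a ∷ w))
  reachable-step Y a w U = mk⇔ forward backward
    where
    forward : reachableFutures (t L Y a) w U → reachableFutures Y (a ∷ w) U
    forward (y′ , y′∈tY , z , y′⟹z , U≐Tz) =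
      let (y , y∈Y , y⟶y′) = Equivalence.to (t-membership Y) y′∈tY
      in y , y∈Y , z , ∷-step y⟶y′ y′⟹z , U≐Tz

    backward : reachableFutures Y (a ∷ w) U → reachableFutures (t L Y a) w U
    backward (y , y∈Y , z , ∷-step {y = y′} y⟶y′ y′⟹z , U≐Tz) =
      y′ , Equivalence.from (t-membership Y) (y , y∈Y , y⟶y′) , z , y′⟹z , U≐Tz

  ⟦⟧≈reachableFutures : ∀ Y w → _≈B_ L (⟦_⟧ L Y w) (reachableFutures Y w)
  ⟦⟧≈reachableFutures Y [] U = mk⇔
    (λ (y , y∈Y , U≐Ty) → y , y∈Y , y , ε-step , U≐Ty)
    (λ { (y , y∈Y , .y , ε-step , U≐Ty) → y , y∈Y , U≐Ty })
  ⟦⟧≈reachableFutures Y (a ∷ w) U =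
    ⇔-trans (⟦⟧≈reachableFutures (t L Y a) w U) (reachable-step Y a w U)

  reachableFutures-singleton : ∀ x w →
    _≈B_ L (reachableFutures (x ∷ []) w) (φPF L x w)
  reachableFutures-singleton x w U = mk⇔
    (λ { (.x , here refl , future) → future })
    (λ future → x , here refl , future)

theorem4p3 : {A : Set} (L : LTS A) (x : LTS.X L) (w : List A) →
    _≈B_ L (⟦_⟧ L (x ∷ []) w) (φPF L x w)
theorem4p3 L x w U =
  ⇔-trans (⟦⟧≈reachableFutures L (x ∷ []) w U)
          (reachableFutures-singleton L x w U)
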